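{- Let $G$ be a connected graph with at least one edge. For any positive integer $b$, \[ \left\lfloor \frac{\chi(G)}{\chi(G)-1}\cdot b\right\rfloor \le T_G(b) \le \left\lfloor\frac{\omega(G)}{\omega(G)-1}\cdot b\right\rfloor, \] where $\chi(G)$ is the chromatic number and $\omega(G)$ the clique number of $G$.
   Context: A vertex cover of $G$ is a set $S$ of vertices such that $V(G)\setminus S$ is independent. For a family (with repetitions allowed) $S_1,\dots,S_t$ of vertex covers, its budget is $\max_{v\in V(G)}|\{i: v\in S_i\}|$. $T_G(b)$ is the largest $t$ such that some family of $t$ vertex covers of $G$ has budget at most $b$. -}

module Defs where

open import Data.Nat using (ℕ; zero; suc; _≤_; _*_; _∸_)
open import Data.Nat.DivMod using (_/_)
open import Data.Bool using (Bool; true; false)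
open import Data.Fin using (Fin)
open import Data.Fin.Subset using (Subset; _∈_; _∉_; ∣_∣)
open import Data.Vec using (lookup; tabulate)
open import Data.Product using (Σ; _×_; ∃; ∃-syntax)
open import Relation.Binary.PropositionalEquality using (_≡_; _≢_)

record Graph (n : ℕ) : Set where
  field
    adj    : Fin n → Fin n → Bool
    sym    : ∀ u v → adj u v ≡ adj v u
    irrefl : ∀ v → adj v v ≡ false
open Graph public

data Reach {n : ℕ} (G : Graph n) : Fin n → Fin n → Set where
  here : ∀ {u} → Reach G u u
  step : ∀ {u w v} → adj G u w ≡ true → Reach G w v → Reach G u v

Connected : ∀ {n} → Graph n → Set
Connected G = ∀ u v → Reach G u v

HasEdge : ∀ {n} → Graph n → Set
HasEdge {n} G = ∃[ u ] ∃[ v ] (adj G u v ≡ true)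

Independent : ∀ {n} → Graph n → (Fin n → Set) → Set
Independent {n} G I = ∀ (u v : Fin n) → I u → I v → adj G u v ≡ false

IsVertexCover : ∀ {n} → Graph n → Subset n → Set
IsVertexCover G S = Independent G (λ v → v ∉ S)

Family : ℕ → ℕ → Set
Family n t = Fin t → Subset n

AllCovers : ∀ {n t} → Graph n → Family n t → Set
AllCovers G F = ∀ i → IsVertexCover G (F i)

load : ∀ {n t} → Family n t → Fin n → ℕ
load F v = ∣ tabulate (λ i → lookup (F i) v) ∣

BudgetAtMost : ∀ {n t} → Family n t → ℕ → Set
BudgetAtMost {n} F b = ∀ (v : Fin n) → load F v ≤ b

Achievable : ∀ {n} → Graph n → ℕ → ℕ → Set
Achievable {n} G b t = Σ (Family n t) (λ F → AllCovers G F × BudgetAtMost F b)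

IsT : ∀ {n} → Graph n → ℕ → ℕ → Set
IsT G b T = Achievable G b T × (∀ t → Achievable G b t → t ≤ T)

ProperColouring : ∀ {n} → Graph n → (k : ℕ) → (Fin n → Fin k) → Set
ProperColouring G k c = ∀ u v → adj G u v ≡ true → c u ≢ c v

Colourable : ∀ {n} → Graph n → ℕ → Set
Colourable {n} G k = Σ (Fin n → Fin k) (ProperColouring G k)

IsChromaticNumber : ∀ {n} → Graph n → ℕ → Set
IsChromaticNumber G k = Colourable G k × (∀ m → Colourable G m → k ≤ m)

IsClique : ∀ {n} → Graph n → Subset n → Set
IsClique G K = ∀ u v → u ∈ K → v ∈ K → u ≢ v → adj G u v ≡ true

IsCliqueNumber : ∀ {n} → Graph n → ℕ → Set
IsCliqueNumber {n} G w =
  (∃[ K ] (IsClique G K × ∣ K ∣ ≡ w)) × (∀ K → IsClique G K → ∣ K ∣ ≤ w)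

-- floor division, with the (unused) convention m ⌊/⌋ 0 = 0
_⌊/⌋_ : ℕ → ℕ → ℕ
m ⌊/⌋ zero = zero
m ⌊/⌋ suc k = m / suc k

ratioFloor : ℕ → ℕ → ℕ
ratioFloor k b = (k * b) ⌊/⌋ (k ∸ 1)

-- Upper bound: a vertex cover misses at most one vertex of a clique K, so t covers
-- of budget b give t (|K| - 1) ≤ Σ_{v ∈ K} load v ≤ |K| b.
-- Lower bound: for a proper k-colouring the complements of the k colour classes are
-- vertex covers using every vertex k - 1 times; writing ⌊k b / (k - 1)⌋ = q k + r with
-- r < k, take q such rounds and r copies of the whole vertex set.
-- Achievability of t is decidable and bounded by the upper bound, so T_G(b) exists.
module Submission where

open import Defs hiding (sym)
open import Data.Bool using (Bool; true; false; not; _∧_) renaming (_≟_ to _≟ᵇ_)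
open import Data.Bool.Properties using (¬-not)
open import Data.Fin using (Fin; zero; suc)
open import Data.Fin.Properties as Fin using (all?) renaming (_≟_ to _≟ᶠ_)
open import Data.Fin.Subset using (Subset; _∈_; _∉_; ∣_∣; ⊤; ⁅_⁆; _∪_)
open import Data.Fin.Subset.Properties
  using ( _∈?_; anySubset?; ∈⊤; x∈⁅x⁆; x∈⁅y⁆⇒x≡y; x≢y⇒x∉⁅y⁆; ∣⁅x⁆∣≡1
        ; x∈p∪q⁺; x∈p∪q⁻; q⊆p∪q; p⊂q⇒∣p∣<∣q∣)
open import Data.Nat using (ℕ; zero; suc; _+_; _*_; _∸_; _≤_; _<_; z≤n; s≤s; _≤?_)
open import Data.Nat.DivMod using (_/_; _%_; m≡m%n+[m/n]*n; m%n<n; m/n*n≤m; m*n/n≡m; /-monoˡ-≤)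
open import Data.Nat.Properties
open import Data.Nat.Tactic.RingSolver using (solve-∀)
open import Data.Product using (Σ; _×_; _,_; ∃-syntax)
open import Data.Sum using (_⊎_; inj₁; inj₂; map)
open import Data.Vec using (lookup; tabulate)
open import Data.Vec.Functional as Vector using ()
open import Data.Vec.Properties
  using ([]=⇒lookup; lookup⇒[]=; lookup∘tabulate; lookup-replicate; tabulate∘lookup)
open import Function using (_∘_)
open import Relation.Nullary using (Dec; yes; no; does; ¬?; contradiction)
open import Relation.Nullary.Decidable using (map′; _×-dec_; _→-dec_)
open import Relation.Binary.PropositionalEquality

∑ : ∀ {m} → (Fin m → ℕ) → ℕ
∑ {zero}  f = 0
∑ {suc m} f = f zero + ∑ (f ∘ suc)

∑-cong : ∀ {m} {f g : Fin m → ℕ} → (∀ i → f i ≡ g i) → ∑ f ≡ ∑ g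
∑-cong {zero}  f≗g = refl
∑-cong {suc m} f≗g = cong₂ _+_ (f≗g zero) (∑-cong (f≗g ∘ suc))

∑-mono-≤ : ∀ {m} {f g : Fin m → ℕ} → (∀ i → f i ≤ g i) → ∑ f ≤ ∑ g
∑-mono-≤ {zero}  f≤g = z≤n
∑-mono-≤ {suc m} f≤g = +-mono-≤ (f≤g zero) (∑-mono-≤ (f≤g ∘ suc))

∑-distrib-+ : ∀ {m} (f g : Fin m → ℕ) → ∑ (λ i → f i + g i) ≡ ∑ f + ∑ g
∑-distrib-+ {zero}  f g = refl
∑-distrib-+ {suc m} f g = begin
  (f zero + g zero) + ∑ (λ i → f (suc i) + g (suc i))
    ≡⟨ cong (f zero + g zero +_) (∑-distrib-+ (f ∘ suc) (g ∘ suc)) ⟩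
  (f zero + g zero) + (∑ (f ∘ suc) + ∑ (g ∘ suc))
    ≡⟨ interchange (f zero) (g zero) (∑ (f ∘ suc)) (∑ (g ∘ suc)) ⟩
  (f zero + ∑ (f ∘ suc)) + (g zero + ∑ (g ∘ suc)) ∎
  where
  open ≡-Reasoning
  interchange : ∀ a b c d → (a + b) + (c + d) ≡ (a + c) + (b + d)
  interchange = solve-∀

∑-distribʳ-* : ∀ {m} (f : Fin m → ℕ) c → ∑ (λ i → f i * c) ≡ ∑ f * c
∑-distribʳ-* {zero}  f c = refl
∑-distribʳ-* {suc m} f c =
  trans (cong (f zero * c +_) (∑-distribʳ-* (f ∘ suc) c)) (sym (*-distribʳ-+ c (f zero) _))

∑-const-1 : ∀ m → ∑ {m} (λ _ → 1) ≡ m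
∑-const-1 zero    = refl
∑-const-1 (suc m) = cong suc (∑-const-1 m)

𝟙 : Bool → ℕ
𝟙 true  = 1
𝟙 false = 0

∣tabulate∣≡∑𝟙 : ∀ {m} (h : Fin m → Bool) → ∣ tabulate h ∣ ≡ ∑ (𝟙 ∘ h)
∣tabulate∣≡∑𝟙 {zero}  h = refl
∣tabulate∣≡∑𝟙 {suc m} h with h zero
... | true  = cong suc (∣tabulate∣≡∑𝟙 (h ∘ suc))
... | false = ∣tabulate∣≡∑𝟙 (h ∘ suc)

∣p∣≡∑𝟙 : ∀ {n} (p : Subset n) → ∣ p ∣ ≡ ∑ (𝟙 ∘ lookup p)
∣p∣≡∑𝟙 p = trans (cong ∣_∣ (sym (tabulate∘lookup p))) (∣tabulate∣≡∑𝟙 (lookup p))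

∑𝟙≡0 : ∀ {m} (h : Fin m → Bool) → (∀ i → h i ≡ false) → ∑ (𝟙 ∘ h) ≡ 0
∑𝟙≡0 {zero}  h h≡false = refl
∑𝟙≡0 {suc m} h h≡false rewrite h≡false zero = ∑𝟙≡0 (h ∘ suc) (h≡false ∘ suc)

∑𝟙≤1 : ∀ {m} (h : Fin m → Bool) → (∀ i j → h i ≡ true → h j ≡ true → i ≡ j) → ∑ (𝟙 ∘ h) ≤ 1
∑𝟙≤1 {zero}  h unique = z≤n
∑𝟙≤1 {suc m} h unique with h zero in h₀
... | true  = ≤-reflexive (cong suc (∑𝟙≡0 (h ∘ suc) tail-false))
  where
  tail-false : ∀ i → h (suc i) ≡ false
  tail-false i with h (suc i) in hᵢ
  ... | true  = contradiction (unique zero (suc i) h₀ hᵢ) λ ()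
  ... | false = refl
... | false = ∑𝟙≤1 (h ∘ suc) λ i j hᵢ hⱼ → Fin.suc-injective (unique (suc i) (suc j) hᵢ hⱼ)

lookup-𝟙≤ : ∀ {n m} (S : Subset n) v → (v ∈ S → 1 ≤ m) → 𝟙 (lookup S v) ≤ m
lookup-𝟙≤ S v ∈⇒1≤m with lookup S v in eq
... | true  = ∈⇒1≤m (lookup⇒[]= v S eq)
... | false = z≤n

module _ {n} (G : Graph n) where

  load-suc : ∀ {t} (F : Family n (suc t)) v → load F v ≡ 𝟙 (lookup (F zero) v) + load (F ∘ suc) v
  load-suc F v with lookup (F zero) v
  ... | true  = refl
  ... | false = refl

  clique∖cover-unique : ∀ {K S} → IsClique G K → IsVertexCover G S →
    ∀ {u v} → u ∈ K → u ∉ S → v ∈ K → v ∉ S → u ≡ v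
  clique∖cover-unique clique cover {u} {v} u∈K u∉S v∈K v∉S with u ≟ᶠ v
  ... | yes u≡v = u≡v
  ... | no  u≢v = contradiction (trans (sym (clique u v u∈K v∈K u≢v)) (cover u v u∉S v∉S)) λ ()

  ∣clique∣≤∣clique∩cover∣+1 : ∀ {K S} → IsClique G K → IsVertexCover G S →
    ∣ K ∣ ≤ ∑ (λ v → 𝟙 (lookup K v) * 𝟙 (lookup S v)) + 1
  ∣clique∣≤∣clique∩cover∣+1 {K} {S} clique cover = begin
    ∣ K ∣                                     ≡⟨ ∣p∣≡∑𝟙 K ⟩
    ∑ (𝟙 ∘ lookup K)                          ≡⟨ ∑-cong (λ v → 𝟙-split (lookup K v) (lookup S v)) ⟩
    ∑ (λ v → 𝟙 (lookup K v) * 𝟙 (lookup S v) + 𝟙 (missed v))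
      ≡⟨ ∑-distrib-+ (λ v → 𝟙 (lookup K v) * 𝟙 (lookup S v)) (𝟙 ∘ missed) ⟩
    ∑ (λ v → 𝟙 (lookup K v) * 𝟙 (lookup S v)) + ∑ (𝟙 ∘ missed)
      ≤⟨ +-monoʳ-≤ _ (∑𝟙≤1 missed missed-unique) ⟩
    ∑ (λ v → 𝟙 (lookup K v) * 𝟙 (lookup S v)) + 1 ∎
    where
    open ≤-Reasoning
    missed : Fin n → Bool
    missed v = lookup K v ∧ not (lookup S v)
    𝟙-split : ∀ k s → 𝟙 k ≡ 𝟙 k * 𝟙 s + 𝟙 (k ∧ not s)
    𝟙-split true  true  = refl
    𝟙-split true  false = refl
    𝟙-split false s     = refl
    missed⇒ : ∀ v → missed v ≡ true → v ∈ K × v ∉ S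
    missed⇒ v _ with lookup K v in Kv | lookup S v in Sv
    ... | true  | false =
      lookup⇒[]= v K Kv , λ v∈S → contradiction (trans (sym ([]=⇒lookup v∈S)) Sv) λ ()
    missed-unique : ∀ u v → missed u ≡ true → missed v ≡ true → u ≡ v
    missed-unique u v mu mv with missed⇒ u mu | missed⇒ v mv
    ... | u∈K , u∉S | v∈K , v∉S = clique∖cover-unique clique cover u∈K u∉S v∈K v∉S

  covers-meet-clique : ∀ {K} → IsClique G K → ∀ {t} (F : Family n t) → AllCovers G F →
    t * ∣ K ∣ ≤ ∑ (λ v → 𝟙 (lookup K v) * load F v) + t
  covers-meet-clique clique {zero}  F covers = z≤n
  covers-meet-clique {K} clique {suc t} F covers = begin
    ∣ K ∣ + t * ∣ K ∣
      ≤⟨ +-mono-≤ (∣clique∣≤∣clique∩cover∣+1 clique (covers zero))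
                  (covers-meet-clique clique (F ∘ suc) (covers ∘ suc)) ⟩
    (∑ head-count + 1) + (∑ tail-count + t)        ≡⟨ shuffle (∑ head-count) (∑ tail-count) t ⟩
    (∑ head-count + ∑ tail-count) + suc t          ≡⟨ cong (_+ suc t) (sym (∑-distrib-+ head-count tail-count)) ⟩
    ∑ (λ v → head-count v + tail-count v) + suc t  ≡⟨ cong (_+ suc t) (∑-cong counts-load) ⟩
    ∑ (λ v → 𝟙 (lookup K v) * load F v) + suc t   ∎
    where
    open ≤-Reasoning
    head-count tail-count : Fin n → ℕ
    head-count v = 𝟙 (lookup K v) * 𝟙 (lookup (F zero) v)
    tail-count v = 𝟙 (lookup K v) * load (F ∘ suc) v
    counts-load : ∀ v → head-count v + tail-count v ≡ 𝟙 (lookup K v) * load F v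
    counts-load v = trans (sym (*-distribˡ-+ (𝟙 (lookup K v)) _ _)) (cong (𝟙 (lookup K v) *_) (sym (load-suc F v)))
    shuffle : ∀ a b c → (a + 1) + (b + c) ≡ (a + b) + suc c
    shuffle = solve-∀

  achievable⇒*∣clique∣≤ : ∀ {K b t} → IsClique G K → Achievable G b t → t * ∣ K ∣ ≤ ∣ K ∣ * b + t
  achievable⇒*∣clique∣≤ {K} {b} {t} clique (F , covers , budget) = begin
    t * ∣ K ∣                                    ≤⟨ covers-meet-clique clique F covers ⟩
    ∑ (λ v → 𝟙 (lookup K v) * load F v) + t
      ≤⟨ +-monoˡ-≤ t (∑-mono-≤ λ v → *-monoʳ-≤ (𝟙 (lookup K v)) (budget v)) ⟩
    ∑ (λ v → 𝟙 (lookup K v) * b) + t            ≡⟨ cong (_+ t) (∑-distribʳ-* (𝟙 ∘ lookup K) b) ⟩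
    ∑ (𝟙 ∘ lookup K) * b + t                    ≡⟨ cong (λ x → x * b + t) (sym (∣p∣≡∑𝟙 K)) ⟩
    ∣ K ∣ * b + t ∎
    where open ≤-Reasoning

  adj⇒≢ : ∀ {u v} → adj G u v ≡ true → u ≢ v
  adj⇒≢ uv refl = contradiction (trans (sym uv) (irrefl G _)) λ ()

  edge-clique : ∀ {u v} → adj G u v ≡ true → IsClique G (⁅ u ⁆ ∪ ⁅ v ⁆)
  edge-clique {u} {v} uv x y x∈ y∈ x≢y with ∈⁅u⁆∪⁅v⁆ x∈ | ∈⁅u⁆∪⁅v⁆ y∈
    where
    ∈⁅u⁆∪⁅v⁆ : ∀ {w} → w ∈ ⁅ u ⁆ ∪ ⁅ v ⁆ → w ≡ u ⊎ w ≡ v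
    ∈⁅u⁆∪⁅v⁆ = map (x∈⁅y⁆⇒x≡y u) (x∈⁅y⁆⇒x≡y v) ∘ x∈p∪q⁻ ⁅ u ⁆ ⁅ v ⁆
  ... | inj₁ refl | inj₁ refl = contradiction refl x≢y
  ... | inj₁ refl | inj₂ refl = uv
  ... | inj₂ refl | inj₁ refl = trans (Graph.sym G v u) uv
  ... | inj₂ refl | inj₂ refl = contradiction refl x≢y

  2≤∣⁅x⁆∪⁅y⁆∣ : ∀ {x y : Fin n} → x ≢ y → 2 ≤ ∣ ⁅ x ⁆ ∪ ⁅ y ⁆ ∣
  2≤∣⁅x⁆∪⁅y⁆∣ {x} {y} x≢y = subst (_< ∣ ⁅ x ⁆ ∪ ⁅ y ⁆ ∣) (∣⁅x⁆∣≡1 y)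
    (p⊂q⇒∣p∣<∣q∣ (q⊆p∪q ⁅ x ⁆ ⁅ y ⁆ , x , x∈p∪q⁺ (inj₁ (x∈⁅x⁆ x)) , x≢y⇒x∉⁅y⁆ x≢y))

  2≤cliqueNumber : ∀ {ω} → HasEdge G → IsCliqueNumber G ω → 2 ≤ ω
  2≤cliqueNumber (u , v , uv) (_ , maximal) =
    ≤-trans (2≤∣⁅x⁆∪⁅y⁆∣ (adj⇒≢ uv)) (maximal _ (edge-clique uv))

*≤*+⇒≤ratioFloor : ∀ {k b t} → 2 ≤ k → t * k ≤ k * b + t → t ≤ ratioFloor k b
*≤*+⇒≤ratioFloor {suc (suc d)} {b} {t} (s≤s (s≤s _)) t*k≤k*b+t = begin
  t                        ≡⟨ sym (m*n/n≡m t (suc d)) ⟩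
  t * suc d / suc d        ≤⟨ /-monoˡ-≤ (suc d) (+-cancelˡ-≤ t _ _ t+t*d≤t+k*b) ⟩
  suc (suc d) * b / suc d  ∎
  where
  open ≤-Reasoning
  t+t*d≤t+k*b : t + t * suc d ≤ t + suc (suc d) * b
  t+t*d≤t+k*b = subst₂ _≤_ (*-suc t (suc d)) (+-comm _ t) t*k≤k*b+t

achievable⇒≤ratioFloor : ∀ {n} (G : Graph n) {ω b t} → HasEdge G → IsCliqueNumber G ω →
  Achievable G b t → t ≤ ratioFloor ω b
achievable⇒≤ratioFloor G edge cliqueNumber@((K , clique , refl) , _) achievable =
  *≤*+⇒≤ratioFloor (2≤cliqueNumber G edge cliqueNumber) (achievable⇒*∣clique∣≤ G clique achievable)

-- The budget b is generalised to a per-vertex bound L, which is what makes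
-- achievability decidable by peeling off one cover at a time.
AchievableWith : ∀ {n} → Graph n → (Fin n → ℕ) → ℕ → Set
AchievableWith {n} G L t = Σ (Family n t) λ F → AllCovers G F × (∀ v → load F v ≤ L v)

module _ {n} (G : Graph n) where

  []-achievableWith : ∀ {L} → AchievableWith G L 0
  []-achievableWith = Vector.[] , (λ ()) , λ _ → z≤n

  achievableWith-mono : ∀ {L L′ t} → (∀ v → L v ≤ L′ v) → AchievableWith G L t → AchievableWith G L′ t
  achievableWith-mono L≤L′ (F , covers , bounded) = F , covers , λ v → ≤-trans (bounded v) (L≤L′ v)

  ∷-achievableWith : ∀ {S L t} → IsVertexCover G S → AchievableWith G L t →
    AchievableWith G (λ v → 𝟙 (lookup S v) + L v) (suc t)
  ∷-achievableWith {S} {L} cover (F , covers , bounded) = S Vector.∷ F , covers′ , bounded′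
    where
    covers′ : AllCovers G (S Vector.∷ F)
    covers′ zero    = cover
    covers′ (suc i) = covers i
    bounded′ : ∀ v → load (S Vector.∷ F) v ≤ 𝟙 (lookup S v) + L v
    bounded′ v = subst (_≤ 𝟙 (lookup S v) + L v) (sym (load-suc G (S Vector.∷ F) v)) (+-monoʳ-≤ _ (bounded v))

  ++-achievableWith : ∀ {m L t} (S : Fin m → Subset n) → (∀ i → IsVertexCover G (S i)) →
    AchievableWith G L t → AchievableWith G (λ v → ∑ (λ i → 𝟙 (lookup (S i) v)) + L v) (m + t)
  ++-achievableWith {zero}  S covers achievable = achievable
  ++-achievableWith {suc m} S covers achievable =
    achievableWith-mono (λ v → ≤-reflexive (sym (+-assoc (𝟙 (lookup (S zero) v)) _ _)))
      (∷-achievableWith (covers zero) (++-achievableWith (S ∘ suc) (covers ∘ suc) achievable))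

  achievableWith-suc⁺ : ∀ {S L t} → IsVertexCover G S → (∀ v → v ∈ S → 1 ≤ L v) →
    AchievableWith G (λ v → L v ∸ 𝟙 (lookup S v)) t → AchievableWith G L (suc t)
  achievableWith-suc⁺ {S} cover available achievable =
    achievableWith-mono (λ v → ≤-reflexive (m+[n∸m]≡n (lookup-𝟙≤ S v (available v))))
      (∷-achievableWith cover achievable)

  achievableWith-suc⁻ : ∀ {L t} → AchievableWith G L (suc t) →
    ∃[ S ] (IsVertexCover G S × (∀ v → v ∈ S → 1 ≤ L v) × AchievableWith G (λ v → L v ∸ 𝟙 (lookup S v)) t)
  achievableWith-suc⁻ {L} (F , covers , bounded) =
    F zero , covers zero , available , F ∘ suc , covers ∘ suc , bounded′
    where
    split : ∀ v → 𝟙 (lookup (F zero) v) + load (F ∘ suc) v ≤ L v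
    split v = subst (_≤ L v) (load-suc G F v) (bounded v)
    available : ∀ v → v ∈ F zero → 1 ≤ L v
    available v v∈F₀ =
      m+n≤o⇒m≤o 1 (subst (λ x → 𝟙 x + load (F ∘ suc) v ≤ L v) ([]=⇒lookup v∈F₀) (split v))
    bounded′ : ∀ v → load (F ∘ suc) v ≤ L v ∸ 𝟙 (lookup (F zero) v)
    bounded′ v =
      m+n≤o⇒m≤o∸n (load (F ∘ suc) v) (subst (_≤ L v) (+-comm (𝟙 (lookup (F zero) v)) _) (split v))

  isVertexCover? : ∀ S → Dec (IsVertexCover G S)
  isVertexCover? S = all? λ u → all? λ v →
    ¬? (u ∈? S) →-dec ¬? (v ∈? S) →-dec adj G u v ≟ᵇ false

  achievableWith? : ∀ L t → Dec (AchievableWith G L t)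
  achievableWith? L zero    = yes []-achievableWith
  achievableWith? L (suc t) =
    map′ (λ (S , cover , available , achievable) → achievableWith-suc⁺ cover available achievable)
         achievableWith-suc⁻
         (anySubset? λ S → isVertexCover? S ×-dec all? (λ v → v ∈? S →-dec 1 ≤? L v)
                                              ×-dec achievableWith? _ t)

  achievable? : ∀ b t → Dec (Achievable G b t)
  achievable? b = achievableWith? (λ _ → b)

  ∉tabulate⇒false : ∀ {s : Fin n → Bool} {v} → v ∉ tabulate s → s v ≡ false
  ∉tabulate⇒false {s} {v} v∉ with s v in eq
  ... | true  = contradiction (lookup⇒[]= v (tabulate s) (trans (lookup∘tabulate s v) eq)) v∉
  ... | false = refl

  ⊤-cover : IsVertexCover G ⊤
  ⊤-cover u v u∉⊤ _ = contradiction ∈⊤ u∉⊤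

∑-𝟙-≢ : ∀ {k} (y : Fin k) → ∑ (λ j → 𝟙 (not (does (y ≟ᶠ j)))) ≡ k ∸ 1
∑-𝟙-≢ {suc k}       zero    = ∑-const-1 k
∑-𝟙-≢ {suc (suc k)} (suc y) = cong suc (∑-𝟙-≢ y)

module _ {n} (G : Graph n) {k} (c : Fin n → Fin k) (proper : ProperColouring G k c) where

  ∁colourClass : Fin k → Subset n
  ∁colourClass j = tabulate λ v → not (does (c v ≟ᶠ j))

  ∁colourClass-cover : ∀ j → IsVertexCover G (∁colourClass j)
  ∁colourClass-cover j u v u∉ v∉ =
    ¬-not (λ uv → proper u v uv (trans (coloured-j u∉) (sym (coloured-j v∉))))
    where
    coloured-j : ∀ {w} → w ∉ ∁colourClass j → c w ≡ j
    coloured-j {w} w∉ with c w ≟ᶠ j | ∉tabulate⇒false G {v = w} w∉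
    ... | yes cw≡j | _  = cw≡j
    ... | no  _    | ()

  ∁colourClasses-load : ∀ v → ∑ (λ j → 𝟙 (lookup (∁colourClass j) v)) ≡ k ∸ 1
  ∁colourClasses-load v =
    trans (∑-cong λ j → cong 𝟙 (lookup∘tabulate (λ w → not (does (c w ≟ᶠ j))) v))
          (∑-𝟙-≢ (c v))

  rounds-achievable : ∀ q → AchievableWith G (λ _ → q * (k ∸ 1)) (q * k)
  rounds-achievable zero    = []-achievableWith G
  rounds-achievable (suc q) =
    achievableWith-mono G (λ v → ≤-reflexive (cong (_+ q * (k ∸ 1)) (∁colourClasses-load v)))
      (++-achievableWith G ∁colourClass ∁colourClass-cover (rounds-achievable q))

-- With k = d + 1 and t = q k + r, r < k: if t d ≤ k b then each vertex is used r + q d ≤ b times.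
r+q*d≤b : ∀ d b q r → r ≤ d → (r + q * suc d) * d ≤ suc d * b → r + q * d ≤ b
r+q*d≤b d b q r r≤d t*d≤k*b = ≤-pred (*-cancelˡ-< (suc d) _ _ (begin-strict
  suc d * (r + q * d)       ≡⟨ expand d q r ⟩
  (r + q * suc d) * d + r   ≤⟨ +-monoˡ-≤ r t*d≤k*b ⟩
  suc d * b + r             <⟨ +-monoʳ-< (suc d * b) (s≤s r≤d) ⟩
  suc d * b + suc d         ≡⟨ collect d b ⟩
  suc d * suc b             ∎))
  where
  open ≤-Reasoning
  expand : ∀ d q r → suc d * (r + q * d) ≡ (r + q * suc d) * d + r
  expand = solve-∀
  collect : ∀ d b → suc d * b + suc d ≡ suc d * suc b
  collect = solve-∀

colourable⇒achievable : ∀ {n} (G : Graph n) {k} b → Colourable G k → Achievable G b (ratioFloor k b)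
colourable⇒achievable G {zero}        b _ = []-achievableWith G
colourable⇒achievable G {suc zero}    b _ = []-achievableWith G
colourable⇒achievable {n} G {suc (suc e)} b (c , proper) =
  subst (Achievable G b) (sym t≡r+q*k)
    (achievableWith-mono G load≤b
      (++-achievableWith G {r} (λ _ → ⊤ {n}) (λ _ → ⊤-cover G) (rounds-achievable G c proper q)))
  where
  k = suc (suc e)
  t = ratioFloor k b
  q = t / k
  r = t % k
  t≡r+q*k : t ≡ r + q * k
  t≡r+q*k = m≡m%n+[m/n]*n t k
  load≤b : ∀ v → ∑ {r} (λ _ → 𝟙 (lookup ⊤ v)) + q * suc e ≤ b
  load≤b v = subst (λ x → x + q * suc e ≤ b) (sym copies-of-⊤)
    (r+q*d≤b (suc e) b q r (≤-pred (m%n<n t k))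
      (subst (λ x → x * suc e ≤ k * b) t≡r+q*k (m/n*n≤m (k * b) (suc e))))
    where
    copies-of-⊤ : ∑ {r} (λ _ → 𝟙 (lookup (⊤ {n}) v)) ≡ r
    copies-of-⊤ = trans (∑-cong {r} λ _ → cong 𝟙 (lookup-replicate v true)) (∑-const-1 r)

greatest : ∀ {P : ℕ → Set} → (∀ t → Dec (P t)) → P 0 → ∀ m → (∀ t → P t → t ≤ m) →
  ∃[ T ] (P T × (∀ t → P t → t ≤ T))
greatest P? P0 zero    ≤m = 0 , P0 , ≤m
greatest P? P0 (suc m) ≤m with P? (suc m)
... | yes Pm = suc m , Pm , ≤m
... | no ¬Pm = greatest P? P0 m λ t Pt → ≤-pred (≤∧≢⇒< (≤m t Pt) λ { refl → ¬Pm Pt })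

proposition3 : ∀ {n : ℕ} (G : Graph n) → Connected G → HasEdge G →
    ∀ (χ ω : ℕ) → IsChromaticNumber G χ → IsCliqueNumber G ω →
    ∀ (b : ℕ) → 1 ≤ b →
    ∃[ T ] (IsT G b T × ratioFloor χ b ≤ T × T ≤ ratioFloor ω b)
proposition3 G _ edge χ ω (χ-colourable , _) cliqueNumber b _ =
  let T , achievable-T , greatest-T =
        greatest (achievable? G b) ([]-achievableWith G) (ratioFloor ω b) upper
  in  T , (achievable-T , greatest-T)
        , greatest-T _ (colourable⇒achievable G b χ-colourable)
        , upper T achievable-T
  where
  upper : ∀ t → Achievable G b t → t ≤ ratioFloor ω b
  upper _ = achievable⇒≤ratioFloor G edge cliqueNumber
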